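{- Let $s$ be a positive integer and let $(f_r)_{r\in\mathbb{N}}$ be a sequence of arithmetic functions with $f_r$ $(r,s)$-even for every $r$. Suppose $r\mapsto f_r(n)$ is multiplicative for every $n$, i.e. $f_{qr}(n)=f_q(n)f_r(n)$ whenever $(q,r)=1$. Then (1) $r\mapsto \hat f_r(n)$ is multiplicative: $\hat f_{qr}(n)=\hat f_q(n)\hat f_r(n)$ for all $n$ whenever $(q,r)=1$; and (2) the two-variable function $(n,r)\mapsto\hat f_r(n)$ is multiplicative: $\hat f_{qr}(mn)=\hat f_q(m)\hat f_r(n)$ for all positive integers $m,n,q,r$ with $(m,n)=(m,r)=(n,q)=(q,r)=1$.
   Context: For a positive integer $s$ and integers $a,b$ not both zero, $(a,b)_s$ denotes the largest $l^s$ ($l\in\mathbb{N}$) dividing both $a$ and $b$. An arithmetic function $f$ is $(r,s)$-even if $f(n)=f((n,r^s)_s)$ for all $n\in\mathbb{N}$; such $f$ is periodic mod $r^s$. For $(r,s)$-even $f_r$, its discrete Fourier transform is $\hat f_r(n)=\sum_{k=1}^{r^s} f_r(k)\exp\left(-\frac{2\pi i k n}{r^s}\right)$. -}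

module Defs where

open import Level using (Level; _⊔_)
open import Algebra.Bundles using (CommutativeRing)
open import Data.Nat using (ℕ; zero; suc; _≤_; _^_; NonZero) renaming (_*_ to _*ℕ_)
open import Data.Nat.Divisibility using (_∣_)
open import Data.Product using (Σ; _×_)
open import Relation.Binary.PropositionalEquality using (_≡_)

record IsGcdₛ (s a b d : ℕ) : Set where
  field
    root      : ℕ
    isPower   : d ≡ root ^ s
    divLeft   : d ∣ a
    divRight  : d ∣ b
    maximal   : ∀ l → (l ^ s) ∣ a → (l ^ s) ∣ b → (l ^ s) ≤ d

module _ {c ℓ : Level} (R : CommutativeRing c ℓ) where
  open CommutativeRing R

  _^ᴿ_ : Carrier → ℕ → Carrier
  x ^ᴿ zero  = 1#
  x ^ᴿ suc n = x * (x ^ᴿ n)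

  -- A compatible system of roots of unity: ω N plays the role of exp(-2πi/N).
  -- (The family exp(-2πi/N) in ℂ satisfies these axioms.)
  record RootSystem : Set (c ⊔ ℓ) where
    field
      ω        : ℕ → Carrier
      ω-one    : ω 1 ≈ 1#
      ω-compat : ∀ a b → .{{NonZero a}} → .{{NonZero b}} → (ω (a *ℕ b) ^ᴿ a) ≈ ω b

  sum1 : ℕ → (ℕ → Carrier) → Carrier
  sum1 zero    g = 0#
  sum1 (suc N) g = sum1 N g + g (suc N)

  IsEven : (r s : ℕ) → (ℕ → Carrier) → Set ℓ
  IsEven r s f = ∀ n d → .{{NonZero n}} → IsGcdₛ s n (r ^ s) d → f n ≈ f d

  dft : RootSystem → (s r : ℕ) → (ℕ → Carrier) → ℕ → Carrier
  dft Ω s r f n = sum1 (r ^ s) (λ k → f k * (RootSystem.ω Ω (r ^ s) ^ᴿ (k *ℕ n)))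

-- An (r,s)-even function is determined by which s-th powers dividing r^s divide its argument, so
-- (after a harmless translation fixing its value at 0) it is periodic mod r^s and invariant under
-- multiplication by units mod r^s. For coprime Q = q^s and R = r^s the Chinese remainder theorem
-- lets k = bQ + aR run over all residues mod QR as a and b run over residues mod Q and mod R; the
-- summand of the transform of f_qr then splits as the product of the summands of the transforms of
-- f_q (at a) and f_r (at b), which gives (1). For (2), unit invariance of f_q shows that the transform
-- of f_q at mn equals its value at m when n is coprime to q, and symmetrically for f_r.
module Submission where

open import Level using (Level)
open import Algebra.Bundles using (CommutativeRing)
open import Data.Nat.Base using (ℕ; zero; suc; NonZero; _^_; _%_; _/_)
  renaming (_+_ to _+ℕ_; _*_ to _*ℕ_)
import Data.Nat.Properties as ℕ
open import Data.Nat.DivMod using (m≡m%n+[m/n]*n; m%n<n)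
open import Data.Nat.Divisibility using (∣-refl)
open import Data.Nat.Coprimality using (Coprime) renaming (sym to coprime-sym)
open import Data.Nat.Tactic.RingSolver using (solve-∀)
open import Data.Fin.Base using (Fin; toℕ; fromℕ; fromℕ<; inject₁)
open import Data.Fin.Properties
  using (toℕ-fromℕ; toℕ-fromℕ<; toℕ-inject₁; toℕ-injective; toℕ<n)
open import Data.Product.Base using (_×_; _,_)
open import Function.Base using (_∘_)
open import Function.Definitions using (Injective)
open import Relation.Binary.PropositionalEquality as ≡ using (_≡_)
open import Defs

module Arithmetic where
  open import Data.Nat.Base
  open import Data.Nat.Properties hiding (_≟_)
  open import Data.Nat.Divisibility
  open import Data.Nat.Coprimality using (Coprime; coprime-divisor) renaming (sym to coprime-sym)
  open import Data.Fin.Base using (Fin; punchOut)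
  open import Data.Fin.Properties using (any?; _≟_; injective⇒≤; punchOut-injective)
  open import Data.Fin.Permutation using (Permutation; permutation)
  open import Data.Product.Base using (∃; _×_; _,_; proj₁; proj₂)
  open import Function.Base using (_∘_)
  open import Function.Bundles using (_⇔_; mk⇔; Equivalence)
  import Function.Properties.Equivalence as ⇔
  open import Function.Definitions using (Injective)
  open import Relation.Binary.PropositionalEquality
  open import Relation.Nullary using (yes; no; contradiction)
  open import Relation.Nullary.Decidable using (_×-dec_)
  open import Relation.Unary using (Decidable)
  open import Algebra.Properties.CommutativeSemigroup *-commutativeSemigroup using (interchange)

  ^-distribʳ-* : ∀ m n o → (m * n) ^ o ≡ m ^ o * n ^ o
  ^-distribʳ-* m n zero    = refl
  ^-distribʳ-* m n (suc o) = trans (cong (m * n *_) (^-distribʳ-* m n o)) (interchange m n (m ^ o) (n ^ o))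

  m≤m^n : ∀ m n .{{_ : NonZero n}} → m ≤ m ^ n
  m≤m^n zero      _       = z≤n
  m≤m^n m@(suc _) (suc n) = m≤m*n m (m ^ n) {{m^n≢0 m n}}

  coprime-∣ˡ : ∀ {d m n} → d ∣ m → Coprime m n → Coprime d n
  coprime-∣ˡ d∣m c (i∣d , i∣n) = c (∣-trans i∣d d∣m , i∣n)

  coprime-*ʳ : ∀ {m n o} → Coprime m n → Coprime m o → Coprime m (n * o)
  coprime-*ʳ cn co (i∣m , i∣no) = co (i∣m , coprime-divisor (coprime-∣ˡ i∣m cn) i∣no)

  coprime-^ʳ : ∀ {m n} o → Coprime m n → Coprime m (n ^ o)
  coprime-^ʳ zero    _ (_ , i∣1) = ∣1⇒≡1 i∣1
  coprime-^ʳ (suc o) c           = coprime-*ʳ c (coprime-^ʳ o c)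

  %≡%⇒∣∸ : ∀ m o n .{{_ : NonZero n}} → m % n ≡ o % n → n ∣ m ∸ o
  %≡%⇒∣∸ m o n eq = divides (m / n ∸ o / n) (begin
    m ∸ o
      ≡⟨ cong₂ _∸_ (m≡m%n+[m/n]*n m n) (m≡m%n+[m/n]*n o n) ⟩
    (m % n + m / n * n) ∸ (o % n + o / n * n)
      ≡⟨ cong (λ t → (m % n + m / n * n) ∸ (t + o / n * n)) eq ⟨
    (m % n + m / n * n) ∸ (m % n + o / n * n)
      ≡⟨ [m+n]∸[m+o]≡n∸o (m % n) (m / n * n) (o / n * n) ⟩
    m / n * n ∸ o / n * n
      ≡⟨ *-distribʳ-∸ n (m / n) (o / n) ⟨
    (m / n ∸ o / n) * n
      ∎)
    where open ≡-Reasoning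

  m+n≢0 : ∀ m n .{{_ : NonZero m}} → NonZero (m + n)
  m+n≢0 (suc _) _ = _

  ∣∧<⇒≡0 : ∀ {m n} → n ∣ m → m < n → m ≡ 0
  ∣∧<⇒≡0 {zero}  _   _   = refl
  ∣∧<⇒≡0 {suc _} n∣m m<n = contradiction n∣m (>⇒∤ m<n)

  -- Truncated subtraction makes this hold without assuming j ≤ i.
  *-%-cancel-≤ : ∀ {n u i} j .{{_ : NonZero n}} → Coprime u n → i < n →
                 (u * i) % n ≡ (u * j) % n → i ≤ j
  *-%-cancel-≤ {n} {u} {i} j c i<n eq =
    m∸n≡0⇒m≤n (∣∧<⇒≡0 n∣i∸j (≤-<-trans (m∸n≤m i j) i<n))
    where
    n∣i∸j : n ∣ i ∸ j
    n∣i∸j = coprime-divisor (coprime-sym c)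
              (subst (n ∣_) (sym (*-distribˡ-∸ u i j)) (%≡%⇒∣∸ (u * i) (u * j) n eq))

  *-%-injective : ∀ {n u i j} .{{_ : NonZero n}} → Coprime u n → i < n → j < n →
                  (u * i) % n ≡ (u * j) % n → i ≡ j
  *-%-injective {i = i} {j} c i<n j<n eq =
    ≤-antisym (*-%-cancel-≤ j c i<n eq) (*-%-cancel-≤ i c j<n (sym eq))

  Greatest≤ : ∀ {p} → (ℕ → Set p) → ℕ → ℕ → Set p
  Greatest≤ P B l = l ≤ B × P l × (∀ k → k ≤ B → P k → k ≤ l)

  greatest≤ : ∀ {p} {P : ℕ → Set p} → Decidable P →
              ∀ {z} B → z ≤ B → P z → ∃ (Greatest≤ P B)
  greatest≤ P? zero    z≤n pz = 0 , z≤n , pz , λ { _ z≤n _ → z≤n }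
  greatest≤ {P = P} P? (suc B) z≤B pz with P? (suc B)
  ... | yes pB  = suc B , ≤-refl , pB , λ _ k≤B _ → k≤B
  ... | no  ¬pB =
    let l , l≤B , pl , max = greatest≤ P? B (below z≤B pz) pz
    in  l , m≤n⇒m≤1+n l≤B , pl , λ k k≤B pk → max k (below k≤B pk) pk
    where
    below : ∀ {k} → k ≤ suc B → P k → k ≤ B
    below k≤B pk = s≤s⁻¹ (≤∧≢⇒< k≤B λ { refl → ¬pB pk })

  record SamePowerDivisors (s Q x y : ℕ) : Set where
    constructor samePowerDivisors
    field agree : ∀ l → l ^ s ∣ Q → (l ^ s ∣ x ⇔ l ^ s ∣ y)

  samePowerDivisors-sym : ∀ {s Q x y} → SamePowerDivisors s Q x y → SamePowerDivisors s Q y x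
  samePowerDivisors-sym (samePowerDivisors same) = samePowerDivisors λ l d → ⇔.sym (same l d)

  samePowerDivisors-trans : ∀ {s Q x y z} → SamePowerDivisors s Q x y → SamePowerDivisors s Q y z →
                            SamePowerDivisors s Q x z
  samePowerDivisors-trans (samePowerDivisors same) (samePowerDivisors same′) =
    samePowerDivisors λ l d → ⇔.trans (same l d) (same′ l d)

  samePowerDivisors-+ : ∀ {s Q m} x → Q ∣ m → SamePowerDivisors s Q x (m + x)
  samePowerDivisors-+ x Q∣m = samePowerDivisors λ l d →
    mk⇔ (∣m∣n⇒∣m+n (∣-trans d Q∣m)) (λ h → ∣m+n∣m⇒∣n h (∣-trans d Q∣m))

  samePowerDivisors-* : ∀ {s Q u} x → Coprime u Q → SamePowerDivisors s Q x (u * x)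
  samePowerDivisors-* {u = u} x c = samePowerDivisors λ l d →
    mk⇔ (∣n⇒∣m*n u) (coprime-divisor (coprime-∣ˡ d (coprime-sym c)))

  isGcdₛ-resp : ∀ {s Q x y d} → SamePowerDivisors s Q x y → IsGcdₛ s x Q d → IsGcdₛ s y Q d
  isGcdₛ-resp (samePowerDivisors same)
    record { root = l ; isPower = refl ; divLeft = d∣x ; divRight = d∣Q ; maximal = max } =
    record
      { root     = l
      ; isPower  = refl
      ; divLeft  = Equivalence.to (same l d∣Q) d∣x
      ; divRight = d∣Q
      ; maximal  = λ k k∣y k∣Q → max k (Equivalence.from (same k k∣Q) k∣y) k∣Q
      }

  isGcdₛ-exists : ∀ s x Q .{{_ : NonZero s}} .{{_ : NonZero Q}} → ∃ (IsGcdₛ s x Q)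
  isGcdₛ-exists s x Q =
    let l , _ , (l∣x , l∣Q) , max = greatest≤ common? Q (>-nonZero⁻¹ Q) (1-common)
    in  l ^ s , record
          { root     = l
          ; isPower  = refl
          ; divLeft  = l∣x
          ; divRight = l∣Q
          ; maximal  = λ k k∣x k∣Q →
              ^-monoˡ-≤ s (max k (≤-trans (m≤m^n k s) (∣⇒≤ k∣Q)) (k∣x , k∣Q))
          }
    where
    CommonPowerDivisor : ℕ → Set
    CommonPowerDivisor l = l ^ s ∣ x × l ^ s ∣ Q

    common? : Decidable CommonPowerDivisor
    common? l = (l ^ s ∣? x) ×-dec (l ^ s ∣? Q)

    1-common : CommonPowerDivisor 1
    1-common rewrite ^-zeroˡ s = 1∣ x , 1∣ Q

  injective⇒surjective : ∀ {n} {f : Fin n → Fin n} → Injective _≡_ _≡_ f →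
                         ∀ y → ∃ λ x → f x ≡ y
  injective⇒surjective {suc m} {f} inj y with any? (λ x → f x ≟ y)
  ... | yes hit  = hit
  ... | no  miss = contradiction (injective⇒≤ skipY-injective) (<-irrefl refl)
    where
    y≢f : ∀ x → y ≢ f x
    y≢f x y≡fx = miss (x , sym y≡fx)

    skipY : Fin (suc m) → Fin m
    skipY x = punchOut (y≢f x)

    skipY-injective : Injective _≡_ _≡_ skipY
    skipY-injective eq = inj (punchOut-injective (y≢f _) (y≢f _) eq)

  injective⇒permutation : ∀ {n} (f : Fin n → Fin n) → Injective _≡_ _≡_ f → Permutation n n
  injective⇒permutation f inj =
    permutation f (proj₁ ∘ surj) (proj₂ ∘ surj) (λ x → inj (proj₂ (surj (f x))))
    where
    surj : ∀ y → ∃ λ x → f x ≡ y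
    surj = injective⇒surjective inj

open Arithmetic

module _ {c ℓ : Level} (R : CommutativeRing c ℓ) where
  open CommutativeRing R
  open import Relation.Binary.Reasoning.Setoid setoid
  open import Algebra.Properties.CommutativeMonoid.Sum +-commutativeMonoid
    using (sum; sum-cong-≋; sum-init-last; sum-permute)
  import Algebra.Properties.CommutativeSemiring.Exp commutativeSemiring as Exp
  open import Algebra.Properties.CommutativeSemigroup +-commutativeSemigroup
    using () renaming (interchange to +-interchange)
  open import Algebra.Properties.CommutativeSemigroup *-commutativeSemigroup
    using () renaming (interchange to *-interchange)

  infixr 8 _↑_
  _↑_ : Carrier → ℕ → Carrier
  _↑_ = _^ᴿ_ R

  ↑≡^ : ∀ x n → x ↑ n ≡ x Exp.^ n
  ↑≡^ x zero    = ≡.refl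
  ↑≡^ x (suc n) = ≡.cong (x *_) (↑≡^ x n)

  ↑-congˡ : ∀ n {x y} → x ≈ y → x ↑ n ≈ y ↑ n
  ↑-congˡ n {x} {y} x≈y rewrite ↑≡^ x n | ↑≡^ y n = Exp.^-congˡ n x≈y

  ↑-homo-* : ∀ x m n → x ↑ (m +ℕ n) ≈ x ↑ m * x ↑ n
  ↑-homo-* x m n rewrite ↑≡^ x (m +ℕ n) | ↑≡^ x m | ↑≡^ x n = Exp.^-homo-* x m n

  ↑-assocʳ : ∀ x m n → (x ↑ m) ↑ n ≈ x ↑ (m *ℕ n)
  ↑-assocʳ x m n rewrite ↑≡^ (x ↑ m) n | ↑≡^ x m | ↑≡^ x (m *ℕ n) = Exp.^-assocʳ x m n

  Periodic : ℕ → (ℕ → Carrier) → Set ℓ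
  Periodic N h = ∀ x → h (x +ℕ N) ≈ h x

  periodic-* : ∀ {N h} → Periodic N h → ∀ m → Periodic (m *ℕ N) h
  periodic-* {h = h} p zero    x = reflexive (≡.cong h (ℕ.+-identityʳ x))
  periodic-* {N} {h} p (suc m) x = begin
    h (x +ℕ (N +ℕ m *ℕ N)) ≡⟨ ≡.cong h (ℕ.+-assoc x N (m *ℕ N)) ⟨
    h (x +ℕ N +ℕ m *ℕ N)   ≈⟨ periodic-* p m (x +ℕ N) ⟩
    h (x +ℕ N)             ≈⟨ p x ⟩
    h x                    ∎

  periodic-% : ∀ {N h} .{{_ : NonZero N}} → Periodic N h → ∀ x → h (x % N) ≈ h x
  periodic-% {N} {h} p x = begin
    h (x % N)               ≈⟨ periodic-* p (x / N) (x % N) ⟨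
    h (x % N +ℕ x / N *ℕ N) ≡⟨ ≡.cong h (m≡m%n+[m/n]*n x N) ⟨
    h x                     ∎

  Σ1 : ℕ → (ℕ → Carrier) → Carrier
  Σ1 = sum1 R

  sum1-cong : ∀ N {g h} → (∀ k → g (suc k) ≈ h (suc k)) → Σ1 N g ≈ Σ1 N h
  sum1-cong zero    _  = refl
  sum1-cong (suc N) eq = +-cong (sum1-cong N eq) (eq N)

  sum1-zero : ∀ N → Σ1 N (λ _ → 0#) ≈ 0#
  sum1-zero zero    = refl
  sum1-zero (suc N) = trans (+-identityʳ _) (sum1-zero N)

  sum1-distrib-+ : ∀ N (g h : ℕ → Carrier) → Σ1 N (λ k → g k + h k) ≈ Σ1 N g + Σ1 N h
  sum1-distrib-+ zero    g h = sym (+-identityˡ 0#)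
  sum1-distrib-+ (suc N) g h =
    trans (+-congʳ (sum1-distrib-+ N g h)) (+-interchange _ _ (g (suc N)) (h (suc N)))

  *-distribˡ-sum1 : ∀ N x (g : ℕ → Carrier) → x * Σ1 N g ≈ Σ1 N (λ k → x * g k)
  *-distribˡ-sum1 zero    x g = zeroʳ x
  *-distribˡ-sum1 (suc N) x g = trans (distribˡ x _ _) (+-congʳ (*-distribˡ-sum1 N x g))

  sum1-comm : ∀ M N (F : ℕ → ℕ → Carrier) →
              Σ1 M (λ a → Σ1 N (F a)) ≈ Σ1 N (λ b → Σ1 M (λ a → F a b))
  sum1-comm zero    N F = sym (sum1-zero N)
  sum1-comm (suc M) N F = trans (+-congʳ (sum1-comm M N F)) (sym (sum1-distrib-+ N _ _))

  sum1-product : ∀ M N (X Y : ℕ → Carrier) →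
                 Σ1 M X * Σ1 N Y ≈ Σ1 M (λ a → Σ1 N (λ b → X a * Y b))
  sum1-product M N X Y = begin
    Σ1 M X * Σ1 N Y                     ≈⟨ *-comm _ _ ⟩
    Σ1 N Y * Σ1 M X                     ≈⟨ *-distribˡ-sum1 M (Σ1 N Y) X ⟩
    Σ1 M (λ a → Σ1 N Y * X a)           ≈⟨ sum1-cong M (λ a → trans (*-comm _ _) (pull-out a)) ⟩
    Σ1 M (λ a → Σ1 N (λ b → X a * Y b)) ∎
    where
    pull-out : ∀ a → X (suc a) * Σ1 N Y ≈ Σ1 N (λ b → X (suc a) * Y b)
    pull-out a = *-distribˡ-sum1 N (X (suc a)) Y

  sum1-+ : ∀ M N (g : ℕ → Carrier) → Σ1 (M +ℕ N) g ≈ Σ1 M g + Σ1 N (λ k → g (M +ℕ k))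
  sum1-+ M zero    g = begin
    Σ1 (M +ℕ 0) g ≡⟨ ≡.cong (λ L → Σ1 L g) (ℕ.+-identityʳ M) ⟩
    Σ1 M g        ≈⟨ +-identityʳ _ ⟨
    Σ1 M g + 0#   ∎
  sum1-+ M (suc N) g = begin
    Σ1 (M +ℕ suc N) g                                     ≡⟨ ≡.cong (λ L → Σ1 L g) (ℕ.+-suc M N) ⟩
    Σ1 (M +ℕ N) g + g (suc (M +ℕ N))                      ≈⟨ +-congʳ (sum1-+ M N g) ⟩
    Σ1 M g + Σ1 N (λ k → g (M +ℕ k)) + g (suc (M +ℕ N))   ≈⟨ +-assoc _ _ _ ⟩
    Σ1 M g + (Σ1 N (λ k → g (M +ℕ k)) + g (suc (M +ℕ N))) ≈⟨ +-congˡ (+-congˡ last-term) ⟨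
    Σ1 M g + Σ1 (suc N) (λ k → g (M +ℕ k))                ∎
    where
    last-term : g (M +ℕ suc N) ≈ g (suc (M +ℕ N))
    last-term = reflexive (≡.cong g (ℕ.+-suc M N))

  sum1-block : ∀ M N (g : ℕ → Carrier) →
               Σ1 N (λ b → Σ1 M (λ a → g (b *ℕ M +ℕ a))) ≈ Σ1 (N *ℕ M) (λ k → g (M +ℕ k))
  sum1-block M zero    g = refl
  sum1-block M (suc N) g = begin
    Σ1 N (λ b → Σ1 M (λ a → g (b *ℕ M +ℕ a))) + Σ1 M (λ a → g (M +ℕ N *ℕ M +ℕ a))
      ≈⟨ +-cong (sum1-block M N g) (sum1-cong M (λ a → reflexive (≡.cong g (ℕ.+-assoc M _ (suc a))))) ⟩
    Σ1 (N *ℕ M) (λ k → g (M +ℕ k)) + Σ1 M (λ a → g (M +ℕ (N *ℕ M +ℕ a)))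
      ≈⟨ sum1-+ (N *ℕ M) M (λ k → g (M +ℕ k)) ⟨
    Σ1 (N *ℕ M +ℕ M) (λ k → g (M +ℕ k))
      ≡⟨ ≡.cong (λ L → Σ1 L (λ k → g (M +ℕ k))) (ℕ.+-comm (N *ℕ M) M) ⟩
    Σ1 (M +ℕ N *ℕ M) (λ k → g (M +ℕ k))
      ∎

  sum1≈sum : ∀ N (g : ℕ → Carrier) → Σ1 N g ≈ sum {N} (λ i → g (suc (toℕ i)))
  sum1≈sum zero    g = refl
  sum1≈sum (suc N) g = begin
    Σ1 N g + g (suc N)
      ≈⟨ +-cong (sum1≈sum N g) (reflexive (≡.cong (g ∘ suc) (≡.sym (toℕ-fromℕ N)))) ⟩
    sum {N} (λ i → g (suc (toℕ i))) + g (suc (toℕ (fromℕ N)))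
      ≈⟨ +-congʳ (sum-cong-≋ {N} (λ i → reflexive (≡.cong (g ∘ suc) (toℕ-inject₁ i)))) ⟨
    sum {N} (λ i → g (suc (toℕ (inject₁ i)))) + g (suc (toℕ (fromℕ N)))
      ≈⟨ sum-init-last (λ i → g (suc (toℕ i))) ⟨
    sum {suc N} (λ i → g (suc (toℕ i)))
      ∎

  sum1≈sum-periodic : ∀ N {h} → Periodic N h → Σ1 N h ≈ sum {N} (λ i → h (toℕ i))
  sum1≈sum-periodic zero        _ = refl
  sum1≈sum-periodic (suc N) {h} p = begin
    Σ1 N h + h (suc N)                    ≈⟨ +-cong (sum1≈sum N h) (p 0) ⟩
    sum {N} (λ i → h (suc (toℕ i))) + h 0 ≈⟨ +-comm _ _ ⟩
    h 0 + sum {N} (λ i → h (suc (toℕ i))) ∎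

  sum1-shift₁ : ∀ N {h} → Periodic N h → Σ1 N (h ∘ suc) ≈ Σ1 N h
  sum1-shift₁ N {h} p = begin
    Σ1 N (h ∘ suc)                  ≈⟨ sum1≈sum-periodic N (p ∘ suc) ⟩
    sum {N} (λ i → h (suc (toℕ i))) ≈⟨ sum1≈sum N h ⟨
    Σ1 N h                          ∎

  sum1-shift : ∀ N {h} → Periodic N h → ∀ c → Σ1 N (λ k → h (c +ℕ k)) ≈ Σ1 N h
  sum1-shift N     p zero    = refl
  sum1-shift N {h} p (suc c) = trans (sum1-shift N {h ∘ suc} (p ∘ suc) c) (sum1-shift₁ N p)

  sum1-*-unit : ∀ N {u h} .{{_ : NonZero N}} → Coprime u N → Periodic N h →
                Σ1 N (λ k → h (u *ℕ k)) ≈ Σ1 N h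
  sum1-*-unit N {u} {h} cop p = begin
    Σ1 N (λ k → h (u *ℕ k))        ≈⟨ sum1≈sum-periodic N hu-periodic ⟩
    sum {N} (λ i → h (u *ℕ toℕ i)) ≈⟨ sum-cong-≋ σ-correct ⟨
    sum {N} (λ i → h (toℕ (σ i)))  ≈⟨ sum-permute (h ∘ toℕ) (injective⇒permutation σ σ-injective) ⟨
    sum {N} (λ i → h (toℕ i))      ≈⟨ sum1≈sum-periodic N p ⟨
    Σ1 N h                         ∎
    where
    hu-periodic : Periodic N (λ k → h (u *ℕ k))
    hu-periodic x = trans (reflexive (≡.cong h (ℕ.*-distribˡ-+ u x N))) (periodic-* p u (u *ℕ x))

    σ : Fin N → Fin N
    σ i = fromℕ< (m%n<n (u *ℕ toℕ i) N)

    toℕ-σ : ∀ i → toℕ (σ i) ≡ (u *ℕ toℕ i) % N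
    toℕ-σ i = toℕ-fromℕ< (m%n<n (u *ℕ toℕ i) N)

    σ-correct : ∀ i → h (toℕ (σ i)) ≈ h (u *ℕ toℕ i)
    σ-correct i = trans (reflexive (≡.cong h (toℕ-σ i))) (periodic-% p (u *ℕ toℕ i))

    σ-injective : Injective _≡_ _≡_ σ
    σ-injective {i} {j} σi≡σj = toℕ-injective (*-%-injective cop (toℕ<n i) (toℕ<n j)
      (≡.trans (≡.sym (toℕ-σ i)) (≡.trans (≡.cong toℕ σi≡σj) (toℕ-σ j))))

  sum1-crt : ∀ M N {G} .{{_ : NonZero M}} .{{_ : NonZero N}} → Coprime M N → Periodic (M *ℕ N) G →
             Σ1 (M *ℕ N) G ≈ Σ1 M (λ a → Σ1 N (λ b → G (b *ℕ M +ℕ N *ℕ a)))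
  sum1-crt M N {G} cop p = begin
    Σ1 (M *ℕ N) G                               ≈⟨ sum1-shift (M *ℕ N) p M ⟨
    Σ1 (M *ℕ N) (λ k → G (M +ℕ k))              ≡⟨ ≡.cong (λ L → Σ1 L (G ∘ (M +ℕ_))) (ℕ.*-comm M N) ⟩
    Σ1 (N *ℕ M) (λ k → G (M +ℕ k))              ≈⟨ sum1-block M N G ⟨
    Σ1 N (λ b → Σ1 M (λ a → G (b *ℕ M +ℕ a)))   ≈⟨ sum1-comm N M (λ b → G ∘ (b *ℕ M +ℕ_)) ⟩
    Σ1 M K                                      ≈⟨ sum1-*-unit M (coprime-sym cop) K-periodic ⟨
    Σ1 M (λ a → K (N *ℕ a))                     ∎
    where
    K : ℕ → Carrier
    K c = Σ1 N (λ b → G (b *ℕ M +ℕ c))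

    K-periodic : Periodic M K
    K-periodic c = begin
      Σ1 N (λ b → G (b *ℕ M +ℕ (c +ℕ M)))
        ≈⟨ sum1-cong N (λ b → reflexive (≡.cong G (shift-eq (suc b) M c))) ⟩
      Σ1 N (λ b → summand (suc b))
        ≈⟨ sum1-shift₁ N summand-periodic ⟩
      Σ1 N summand
        ∎
      where
      shift-eq : ∀ b M c → b *ℕ M +ℕ (c +ℕ M) ≡ (1 +ℕ b) *ℕ M +ℕ c
      shift-eq = solve-∀

      period-eq : ∀ b N M c → (b +ℕ N) *ℕ M +ℕ c ≡ b *ℕ M +ℕ c +ℕ M *ℕ N
      period-eq = solve-∀

      summand : ℕ → Carrier
      summand b = G (b *ℕ M +ℕ c)

      summand-periodic : Periodic N summand
      summand-periodic b = trans (reflexive (≡.cong G (period-eq b N M c))) (p (b *ℕ M +ℕ c))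

  record IsUnitInvariant (N : ℕ) (g : ℕ → Carrier) : Set ℓ where
    field
      periodic       : Periodic N g
      unit-invariant : ∀ u x → Coprime u N → g (u *ℕ x) ≈ g x

  -- IsEven constrains f only at positive arguments, so f 0 is arbitrary; the translate of f by the
  -- period r ^ s agrees with f at positive arguments and is periodic and unit invariant on all of ℕ.
  shiftBy : ℕ → (ℕ → Carrier) → ℕ → Carrier
  shiftBy N g x = g (N +ℕ x)

  module _ (s r : ℕ) .{{_ : NonZero s}} .{{_ : NonZero r}} {f : ℕ → Carrier}
           (even : IsEven R r s f) where

    private instance
      rˢ≢0 : NonZero (r ^ s)
      rˢ≢0 = ℕ.m^n≢0 r s

    even-resp : ∀ x y .{{_ : NonZero x}} .{{_ : NonZero y}} →
                SamePowerDivisors s (r ^ s) x y → f x ≈ f y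
    even-resp x y same =
      let d , gcd = isGcdₛ-exists s x (r ^ s)
      in  trans (even x d gcd) (sym (even y d (isGcdₛ-resp same gcd)))

    even-shift-resp : ∀ x y → SamePowerDivisors s (r ^ s) x y →
                      shiftBy (r ^ s) f x ≈ shiftBy (r ^ s) f y
    even-shift-resp x y same =
      even-resp (r ^ s +ℕ x) (r ^ s +ℕ y) {{m+n≢0 (r ^ s) x}} {{m+n≢0 (r ^ s) y}}
      (samePowerDivisors-trans (samePowerDivisors-sym (samePowerDivisors-+ x ∣-refl))
        (samePowerDivisors-trans same (samePowerDivisors-+ y ∣-refl)))

    even-shift-positive : ∀ k → f (suc k) ≈ shiftBy (r ^ s) f (suc k)
    even-shift-positive k = even-resp (suc k) (r ^ s +ℕ suc k) {{_}} {{m+n≢0 (r ^ s) (suc k)}}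
      (samePowerDivisors-+ (suc k) ∣-refl)

    even-shift-isUnitInvariant : IsUnitInvariant (r ^ s) (shiftBy (r ^ s) f)
    even-shift-isUnitInvariant = record
      { periodic       = λ x → even-shift-resp (x +ℕ r ^ s) x
          (samePowerDivisors-sym (≡.subst (SamePowerDivisors s (r ^ s) x) (ℕ.+-comm (r ^ s) x)
            (samePowerDivisors-+ x ∣-refl)))
      ; unit-invariant = λ u x cop →
          even-shift-resp (u *ℕ x) x (samePowerDivisors-sym (samePowerDivisors-* x cop))
      }

  module _ (Ω : RootSystem R) where
    open RootSystem Ω

    ω-↑-self : ∀ N .{{_ : NonZero N}} → ω N ↑ N ≈ 1#
    ω-↑-self N = begin
      ω N ↑ N        ≡⟨ ≡.cong (λ L → ω L ↑ N) (ℕ.*-identityʳ N) ⟨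
      ω (N *ℕ 1) ↑ N ≈⟨ ω-compat N 1 ⟩
      ω 1            ≈⟨ ω-one ⟩
      1#             ∎

    ω-periodic : ∀ N .{{_ : NonZero N}} → Periodic N (ω N ↑_)
    ω-periodic N x = begin
      ω N ↑ (x +ℕ N)    ≈⟨ ↑-homo-* (ω N) x N ⟩
      ω N ↑ x * ω N ↑ N ≈⟨ *-congˡ (ω-↑-self N) ⟩
      ω N ↑ x * 1#      ≈⟨ *-identityʳ _ ⟩
      ω N ↑ x           ∎

    character-periodic : ∀ N n .{{_ : NonZero N}} → Periodic N (λ k → ω N ↑ (k *ℕ n))
    character-periodic N n x = begin
      ω N ↑ ((x +ℕ N) *ℕ n)    ≡⟨ ≡.cong (ω N ↑_) (distrib-eq x N n) ⟩
      ω N ↑ (x *ℕ n +ℕ n *ℕ N) ≈⟨ periodic-* (ω-periodic N) n (x *ℕ n) ⟩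
      ω N ↑ (x *ℕ n)           ∎
      where
      distrib-eq : ∀ x N n → (x +ℕ N) *ℕ n ≡ x *ℕ n +ℕ n *ℕ N
      distrib-eq = solve-∀

    ω-↑-split : ∀ M N .{{_ : NonZero M}} .{{_ : NonZero N}} x y →
                ω (M *ℕ N) ↑ (N *ℕ x +ℕ M *ℕ y) ≈ ω M ↑ x * ω N ↑ y
    ω-↑-split M N x y = begin
      ω (M *ℕ N) ↑ (N *ℕ x +ℕ M *ℕ y)
        ≈⟨ ↑-homo-* _ (N *ℕ x) (M *ℕ y) ⟩
      ω (M *ℕ N) ↑ (N *ℕ x) * ω (M *ℕ N) ↑ (M *ℕ y)
        ≈⟨ *-cong (↑-assocʳ _ N x) (↑-assocʳ _ M y) ⟨
      (ω (M *ℕ N) ↑ N) ↑ x * (ω (M *ℕ N) ↑ M) ↑ y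
        ≈⟨ *-cong (↑-congˡ x ωMN↑N) (↑-congˡ y (ω-compat M N)) ⟩
      ω M ↑ x * ω N ↑ y
        ∎
      where
      ωMN↑N : ω (M *ℕ N) ↑ N ≈ ω M
      ωMN↑N = trans (reflexive (≡.cong (λ L → ω L ↑ N) (ℕ.*-comm M N))) (ω-compat N M)

    fourier : ℕ → (ℕ → Carrier) → ℕ → Carrier
    fourier N g n = Σ1 N (λ k → g k * ω N ↑ (k *ℕ n))

    fourier-cong : ∀ N {g h} n → (∀ k → g (suc k) ≈ h (suc k)) → fourier N g n ≈ fourier N h n
    fourier-cong N n eq = sum1-cong N (λ k → *-congʳ (eq k))

    fourier-* : ∀ M N n .{{_ : NonZero M}} .{{_ : NonZero N}} → Coprime M N → ∀ {A B} →
                IsUnitInvariant M A → IsUnitInvariant N B →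
                fourier (M *ℕ N) (λ k → A k * B k) n ≈ fourier M A n * fourier N B n
    fourier-* M N n cop {A} {B} invA invB = begin
      fourier (M *ℕ N) (λ k → A k * B k) n
        ≈⟨ sum1-crt M N cop G-periodic ⟩
      Σ1 M (λ a → Σ1 N (λ b → G (b *ℕ M +ℕ N *ℕ a)))
        ≈⟨ sum1-cong M (λ a → sum1-cong N (λ b → G-factors (suc a) (suc b))) ⟩
      Σ1 M (λ a → Σ1 N (λ b → X a * Y b))
        ≈⟨ sum1-product M N X Y ⟨
      fourier M A n * fourier N B n
        ∎
      where
      module A = IsUnitInvariant invA
      module B = IsUnitInvariant invB

      instance
        MN≢0 : NonZero (M *ℕ N)
        MN≢0 = ℕ.m*n≢0 M N

      G X Y : ℕ → Carrier
      G k = (A k * B k) * ω (M *ℕ N) ↑ (k *ℕ n)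
      X a = A a * ω M ↑ (a *ℕ n)
      Y b = B b * ω N ↑ (b *ℕ n)

      G-periodic : Periodic (M *ℕ N) G
      G-periodic x =
        *-cong (*-cong A-periodic (periodic-* B.periodic M x)) (character-periodic (M *ℕ N) n x)
        where
        A-periodic : A (x +ℕ M *ℕ N) ≈ A x
        A-periodic =
          trans (reflexive (≡.cong (λ L → A (x +ℕ L)) (ℕ.*-comm M N))) (periodic-* A.periodic N x)

      G-factors : ∀ a b → G (b *ℕ M +ℕ N *ℕ a) ≈ X a * Y b
      G-factors a b = begin
        (A k * B k) * ω (M *ℕ N) ↑ (k *ℕ n)             ≈⟨ *-cong (*-cong A-factor B-factor) ω-factor ⟩
        (A a * B b) * (ω M ↑ (a *ℕ n) * ω N ↑ (b *ℕ n)) ≈⟨ *-interchange _ _ _ _ ⟩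
        X a * Y b                                       ∎
        where
        k = b *ℕ M +ℕ N *ℕ a

        A-factor : A k ≈ A a
        A-factor = begin
          A k                 ≡⟨ ≡.cong A (ℕ.+-comm (b *ℕ M) (N *ℕ a)) ⟩
          A (N *ℕ a +ℕ b *ℕ M) ≈⟨ periodic-* A.periodic b (N *ℕ a) ⟩
          A (N *ℕ a)          ≈⟨ A.unit-invariant N a (coprime-sym cop) ⟩
          A a                 ∎

        B-factor : B k ≈ B b
        B-factor = begin
          B k                 ≡⟨ ≡.cong (λ t → B (t +ℕ N *ℕ a)) (ℕ.*-comm b M) ⟩
          B (M *ℕ b +ℕ N *ℕ a) ≡⟨ ≡.cong (λ t → B (M *ℕ b +ℕ t)) (ℕ.*-comm N a) ⟩
          B (M *ℕ b +ℕ a *ℕ N) ≈⟨ periodic-* B.periodic a (M *ℕ b) ⟩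
          B (M *ℕ b)          ≈⟨ B.unit-invariant M b cop ⟩
          B b                 ∎

        exponent-eq : ∀ a b M N n →
                      (b *ℕ M +ℕ N *ℕ a) *ℕ n ≡ N *ℕ (a *ℕ n) +ℕ M *ℕ (b *ℕ n)
        exponent-eq = solve-∀

        ω-factor : ω (M *ℕ N) ↑ (k *ℕ n) ≈ ω M ↑ (a *ℕ n) * ω N ↑ (b *ℕ n)
        ω-factor = trans (reflexive (≡.cong (ω (M *ℕ N) ↑_) (exponent-eq a b M N n)))
                         (ω-↑-split M N (a *ℕ n) (b *ℕ n))

    fourier-*-unit : ∀ N m {u A} .{{_ : NonZero N}} → Coprime u N → IsUnitInvariant N A →
                     fourier N A (m *ℕ u) ≈ fourier N A m
    fourier-*-unit N m {u} {A} cop invA = begin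
      fourier N A (m *ℕ u)    ≈⟨ sum1-cong N (λ k → *-cong (sym (unit-invariant u _ cop)) (ω-eq (suc k))) ⟩
      Σ1 N (λ k → H (u *ℕ k)) ≈⟨ sum1-*-unit N cop H-periodic ⟩
      fourier N A m           ∎
      where
      open IsUnitInvariant invA

      H : ℕ → Carrier
      H k = A k * ω N ↑ (k *ℕ m)

      H-periodic : Periodic N H
      H-periodic x = *-cong (periodic x) (character-periodic N m x)

      exponent-eq : ∀ k m u → k *ℕ (m *ℕ u) ≡ u *ℕ k *ℕ m
      exponent-eq = solve-∀

      ω-eq : ∀ k → ω N ↑ (k *ℕ (m *ℕ u)) ≈ ω N ↑ (u *ℕ k *ℕ m)
      ω-eq k = reflexive (≡.cong (ω N ↑_) (exponent-eq k m u))

    module _ (s : ℕ) .{{_ : NonZero s}} where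

      dft-even : ∀ r n .{{_ : NonZero r}} {f} → IsEven R r s f →
                 dft R Ω s r f n ≈ fourier (r ^ s) (shiftBy (r ^ s) f) n
      dft-even r n even = fourier-cong (r ^ s) n (even-shift-positive s r even)

      dft-*-unit : ∀ r m {u f} .{{_ : NonZero r}} → IsEven R r s f → Coprime u r →
                   dft R Ω s r f (m *ℕ u) ≈ dft R Ω s r f m
      dft-*-unit r m {u} {f} even cop = begin
        dft R Ω s r f (m *ℕ u)                      ≈⟨ dft-even r (m *ℕ u) even ⟩
        fourier (r ^ s) (shiftBy (r ^ s) f) (m *ℕ u) ≈⟨ fourier-*-unit (r ^ s) m (coprime-^ʳ s cop) invariant ⟩
        fourier (r ^ s) (shiftBy (r ^ s) f) m        ≈⟨ dft-even r m even ⟨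
        dft R Ω s r f m                             ∎
        where
        instance
          rˢ≢0 : NonZero (r ^ s)
          rˢ≢0 = ℕ.m^n≢0 r s

        invariant : IsUnitInvariant (r ^ s) (shiftBy (r ^ s) f)
        invariant = even-shift-isUnitInvariant s r even

      dft-* : ∀ q r n .{{_ : NonZero q}} .{{_ : NonZero r}} {f g h : ℕ → Carrier} →
              IsEven R q s f → IsEven R r s g → Coprime q r →
              (∀ k → h (suc k) ≈ f (suc k) * g (suc k)) →
              dft R Ω s (q *ℕ r) h n ≈ dft R Ω s q f n * dft R Ω s r g n
      dft-* q r n {f} {g} {h} evenq evenr cop h≈fg = begin
        dft R Ω s (q *ℕ r) h n
          ≡⟨ ≡.cong (λ L → fourier L h n) (^-distribʳ-* q r s) ⟩
        fourier (q ^ s *ℕ r ^ s) h n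
          ≈⟨ fourier-cong (q ^ s *ℕ r ^ s) n h≈f⁺g⁺ ⟩
        fourier (q ^ s *ℕ r ^ s) (λ k → f⁺ k * g⁺ k) n
          ≈⟨ fourier-* (q ^ s) (r ^ s) n qˢ⊥rˢ (even-shift-isUnitInvariant s q evenq)
                                                (even-shift-isUnitInvariant s r evenr) ⟩
        fourier (q ^ s) f⁺ n * fourier (r ^ s) g⁺ n
          ≈⟨ *-cong (dft-even q n evenq) (dft-even r n evenr) ⟨
        dft R Ω s q f n * dft R Ω s r g n
          ∎
        where
        instance
          qˢ≢0 : NonZero (q ^ s)
          qˢ≢0 = ℕ.m^n≢0 q s
          rˢ≢0 : NonZero (r ^ s)
          rˢ≢0 = ℕ.m^n≢0 r s

        f⁺ g⁺ : ℕ → Carrier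
        f⁺ = shiftBy (q ^ s) f
        g⁺ = shiftBy (r ^ s) g

        h≈f⁺g⁺ : ∀ k → h (suc k) ≈ f⁺ (suc k) * g⁺ (suc k)
        h≈f⁺g⁺ k = trans (h≈fg k) (*-cong (even-shift-positive s q evenq k) (even-shift-positive s r evenr k))

        qˢ⊥rˢ : Coprime (q ^ s) (r ^ s)
        qˢ⊥rˢ = coprime-sym (coprime-^ʳ s (coprime-sym (coprime-^ʳ s cop)))

open import Data.Nat.Base using (_*_)

mainTheorem7 : {c ℓ : Level} (R : CommutativeRing c ℓ) (Ω : RootSystem R)
    (s : ℕ) → .{{NonZero s}} → (f : ℕ → ℕ → CommutativeRing.Carrier R) →
    (∀ r → .{{NonZero r}} → IsEven R r s (f r)) →
    (∀ q r n → .{{NonZero q}} → .{{NonZero r}} → .{{NonZero n}} → Coprime q r →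
      CommutativeRing._≈_ R (f (q * r) n) (CommutativeRing._*_ R (f q n) (f r n))) →
    (∀ q r n → .{{NonZero q}} → .{{NonZero r}} → .{{NonZero n}} → Coprime q r →
      CommutativeRing._≈_ R (dft R Ω s (q * r) (f (q * r)) n)
        (CommutativeRing._*_ R (dft R Ω s q (f q) n) (dft R Ω s r (f r) n)))
    × (∀ m n q r → .{{NonZero m}} → .{{NonZero n}} → .{{NonZero q}} → .{{NonZero r}} →
      Coprime m n → Coprime m r → Coprime n q → Coprime q r →
      CommutativeRing._≈_ R (dft R Ω s (q * r) (f (q * r)) (m * n))
        (CommutativeRing._*_ R (dft R Ω s q (f q) m) (dft R Ω s r (f r) n)))
mainTheorem7 R Ω s f even mult =
    (λ q r n cop → dft-fqr q r n cop)
  , (λ m n q r _ m⊥r n⊥q q⊥r → trans (dft-fqr q r (m * n) q⊥r)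
       (*-cong (dft-*-unit R Ω s q m (even q) n⊥q)
               (trans (reflexive (≡.cong (dft R Ω s r (f r)) (ℕ.*-comm m n)))
                      (dft-*-unit R Ω s r n (even r) m⊥r))))
  where
  open CommutativeRing R using (_≈_; trans; reflexive; *-cong) renaming (_*_ to _·_)

  dft-fqr : ∀ q r n .{{_ : NonZero q}} .{{_ : NonZero r}} → Coprime q r →
            dft R Ω s (q * r) (f (q * r)) n ≈ dft R Ω s q (f q) n · dft R Ω s r (f r) n
  dft-fqr q r n cop = dft-* R Ω s q r n (even q) (even r) cop (λ k → mult q r (suc k) cop)
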